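{- Let $w\in\{\mathtt{0},\mathtt{1}\}^*$ and let $m,n,o,p\in\mathbb{Z}[q]$ be such that $\mu_q(w)=\begin{pmatrix} m & n\\ o & p\end{pmatrix}$. Then $m$, $p$, $qm-q^2n+o$ and $(q+q^2)m-(q^2+q^3+q^4)n+o-qp$ are nonzero polynomials with nonnegative coefficients. Moreover, $o$ and $n$ are nonzero polynomials with nonnegative coefficients, except if $w$ is empty, in which case $o=n=0$.
   Context: $\mu_q$ is the monoid homomorphism $\{\mathtt{0},\mathtt{1}\}^*\to\mathrm{GL}_2(\mathbb{Z}[q^{\pm1}])$ with $\mu_q(\mathtt{0})=\begin{pmatrix} q+q^2 & 1\\ q & 1\end{pmatrix}$ and $\mu_q(\mathtt{1})=\begin{pmatrix} q+2q^2+q^3+q^4 & 1+q\\ q+q^2 & 1\end{pmatrix}$ (so $\mu_q$ of the empty word is the identity matrix). -}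

module Defs where

open import Data.Integer using (ℤ; +_; 0ℤ; 1ℤ; _≤_) renaming (_+_ to _+ℤ_; _*_ to _*ℤ_; -_ to -ℤ_)
open import Data.Nat using (ℕ; zero; suc)
open import Data.List using (List; []; _∷_; map)
open import Data.List.Relation.Unary.All using (All)
open import Data.List.Relation.Unary.Any using (Any)
open import Data.Product using (_×_)
open import Relation.Binary.PropositionalEquality using (_≡_)
open import Relation.Nullary using (¬_)

-- Polynomials in ℤ[q] as coefficient lists, lowest degree first:
-- [a₀ , a₁ , … , a_d] represents a₀ + a₁ q + … + a_d q^d.
-- Trailing zeros are allowed (so the same polynomial may have several representations);
-- all predicates below are invariant under trailing zeros.
Poly : Set
Poly = List ℤ

infixl 6 _⊕_ _⊖_
infixl 7 _⊛_

_⊕_ : Poly → Poly → Poly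
[]       ⊕ g        = g
(a ∷ f)  ⊕ []       = a ∷ f
(a ∷ f)  ⊕ (b ∷ g)  = (a +ℤ b) ∷ (f ⊕ g)

⊝_ : Poly → Poly
⊝ f = map -ℤ_ f

_⊖_ : Poly → Poly → Poly
f ⊖ g = f ⊕ (⊝ g)

_·_ : ℤ → Poly → Poly
c · f = map (c *ℤ_) f

_⊛_ : Poly → Poly → Poly
[]      ⊛ g = []
(a ∷ f) ⊛ g = (a · g) ⊕ (0ℤ ∷ (f ⊛ g))

const : ℤ → Poly
const c = c ∷ []

𝟘 𝟙 : Poly
𝟘 = []
𝟙 = const 1ℤ

qpow : ℕ → Poly
qpow zero    = 𝟙
qpow (suc k) = 0ℤ ∷ qpow k

IsZeroPoly : Poly → Set
IsZeroPoly f = All (_≡ 0ℤ) f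

NonNegCoeffs : Poly → Set
NonNegCoeffs f = All (0ℤ ≤_) f

NonZeroPoly : Poly → Set
NonZeroPoly f = Any (λ c → ¬ (c ≡ 0ℤ)) f

NonzeroNonneg : Poly → Set
NonzeroNonneg f = NonZeroPoly f × NonNegCoeffs f

record Mat : Set where
  constructor mat
  field
    m n o p : Poly
open Mat public

_⊗_ : Mat → Mat → Mat
mat a b c d ⊗ mat a' b' c' d' =
  mat (a ⊛ a' ⊕ b ⊛ c') (a ⊛ b' ⊕ b ⊛ d')
      (c ⊛ a' ⊕ d ⊛ c') (c ⊛ b' ⊕ d ⊛ d')

I₂ : Mat
I₂ = mat 𝟙 𝟘 𝟘 𝟙

data Letter : Set where
  𝟶 𝟷 : Letter

Word : Set
Word = List Letter

μ₁ : Letter → Mat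
μ₁ 𝟶 = mat (qpow 1 ⊕ qpow 2) 𝟙 (qpow 1) 𝟙
μ₁ 𝟷 = mat (qpow 1 ⊕ const (+ 2) ⊛ qpow 2 ⊕ qpow 3 ⊕ qpow 4) (𝟙 ⊕ qpow 1) (qpow 1 ⊕ qpow 2) 𝟙

μ : Word → Mat
μ []      = I₂
μ (a ∷ w) = μ₁ a ⊗ μ w

-- Write S = μ_q(w) = (m n ; o p) and read w from the right, i.e. study S ↦ S μ_q(a).
-- Both Λ₁(S) = q m − q² n + o and Λ₂(S) = (q + q²) m − (q² + q³ + q⁴) n + o − q p
-- transform linearly: Λ₁(S μ_q(a)) is a combination of m, n, o, p whose coefficients
-- are polynomials with nonnegative coefficients, the one of p being nonzero, and
-- Λ₂(S μ_q(a)) is q² Λ₁(S) plus such a combination.  So the conditions "m, p nonzero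
-- and nonnegative, n, o nonnegative, Λ₁ and Λ₂ nonzero and nonnegative" pass from S
-- to S μ_q(a); and as μ_q(a) has nonzero nonnegative entries, so do all four entries
-- of S μ_q(a).
module Submission where

open import Defs
open import Algebra using (CommutativeRing; CommutativeSemigroup)
open import Data.Empty using (⊥-elim)
open import Data.Integer using (ℤ; +_; 0ℤ; 1ℤ; _+_; _*_; -_; _≤_; +≤+)
import Data.Integer.Properties as ℤ
open import Data.List using ([]; _∷_; _∷ʳ_)
open import Data.List.Relation.Unary.All using ([]; _∷_; all?)
import Data.List.Relation.Unary.All.Properties as All
open import Data.List.Relation.Unary.Any using (here; there; any?)
import Data.List.Relation.Unary.Any.Properties as Any
open import Data.List.Reverse using (Reverse; []; _∶_∶ʳ_; reverseView)
open import Data.Maybe using (Maybe; just; nothing)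
open import Data.Nat using (ℕ; zero; suc; z≤n)
open import Data.Product using (_×_; _,_; proj₂; ∃)
open import Data.Sum using ([_,_]′)
open import Function using (_∘_)
open import Level using (0ℓ)
open import Relation.Binary using (IsEquivalence; Setoid)
open import Relation.Binary.PropositionalEquality using (_≡_; _≢_; refl; sym; trans; cong; cong₂; subst; ≢-sym)
open import Relation.Nullary using (¬_; yes; no; ¬?; _×-dec_)
open import Relation.Nullary.Decidable using (from-yes)
open import Relation.Unary using (Decidable)
open import Tactic.RingSolver using (solve-∀)
open import Tactic.RingSolver.Core.AlmostCommutativeRing using (AlmostCommutativeRing; fromCommutativeRing)

coeff : Poly → ℕ → ℤ
coeff []      _       = 0ℤ
coeff (a ∷ f) zero    = a
coeff (a ∷ f) (suc k) = coeff f k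

infix 4 _≈_
record _≈_ (f g : Poly) : Set where
  constructor coeffwise
  field coeff-≡ : ∀ k → coeff f k ≡ coeff g k

≈-refl : ∀ {f} → f ≈ f
≈-refl = coeffwise λ _ → refl

≈-sym : ∀ {f g} → f ≈ g → g ≈ f
≈-sym (coeffwise f≈g) = coeffwise λ k → sym (f≈g k)

≈-trans : ∀ {f g h} → f ≈ g → g ≈ h → f ≈ h
≈-trans (coeffwise f≈g) (coeffwise g≈h) = coeffwise λ k → trans (f≈g k) (g≈h k)

≈-isEquivalence : IsEquivalence _≈_
≈-isEquivalence = record { refl = ≈-refl ; sym = ≈-sym ; trans = ≈-trans }

≈-setoid : Setoid 0ℓ 0ℓ
≈-setoid = record { isEquivalence = ≈-isEquivalence }

∷-cong : ∀ {a b f g} → a ≡ b → f ≈ g → a ∷ f ≈ b ∷ g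
∷-cong a≡b (coeffwise f≈g) = coeffwise λ { zero → a≡b ; (suc k) → f≈g k }

∷-≈𝟘 : ∀ {a f} → a ≡ 0ℤ → f ≈ 𝟘 → a ∷ f ≈ 𝟘
∷-≈𝟘 a≡0 (coeffwise f≈𝟘) = coeffwise λ { zero → a≡0 ; (suc k) → f≈𝟘 k }

coeff-⊕ : ∀ f g k → coeff (f ⊕ g) k ≡ coeff f k + coeff g k
coeff-⊕ []      g       k       = sym (ℤ.+-identityˡ _)
coeff-⊕ (a ∷ f) []      k       = sym (ℤ.+-identityʳ _)
coeff-⊕ (a ∷ f) (b ∷ g) zero    = refl
coeff-⊕ (a ∷ f) (b ∷ g) (suc k) = coeff-⊕ f g k

coeff-⊝ : ∀ f k → coeff (⊝ f) k ≡ - coeff f k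
coeff-⊝ []      k       = refl
coeff-⊝ (a ∷ f) zero    = refl
coeff-⊝ (a ∷ f) (suc k) = coeff-⊝ f k

coeff-· : ∀ c f k → coeff (c · f) k ≡ c * coeff f k
coeff-· c []      k       = sym (ℤ.*-zeroʳ c)
coeff-· c (a ∷ f) zero    = refl
coeff-· c (a ∷ f) (suc k) = coeff-· c f k

⊕-cong : ∀ {f f′ g g′} → f ≈ f′ → g ≈ g′ → f ⊕ g ≈ f′ ⊕ g′
⊕-cong {f} {f′} {g} {g′} (coeffwise f≈f′) (coeffwise g≈g′) = coeffwise λ k →
  trans (coeff-⊕ f g k) (trans (cong₂ _+_ (f≈f′ k) (g≈g′ k)) (sym (coeff-⊕ f′ g′ k)))

⊝-cong : ∀ {f g} → f ≈ g → ⊝ f ≈ ⊝ g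
⊝-cong {f} {g} (coeffwise f≈g) = coeffwise λ k →
  trans (coeff-⊝ f k) (trans (cong -_ (f≈g k)) (sym (coeff-⊝ g k)))

·-congʳ : ∀ c {f g} → f ≈ g → c · f ≈ c · g
·-congʳ c {f} {g} (coeffwise f≈g) = coeffwise λ k →
  trans (coeff-· c f k) (trans (cong (c *_) (f≈g k)) (sym (coeff-· c g k)))

⊕-assoc : ∀ f g h → (f ⊕ g) ⊕ h ≈ f ⊕ (g ⊕ h)
⊕-assoc []      g       h       = ≈-refl
⊕-assoc (a ∷ f) []      h       = ≈-refl
⊕-assoc (a ∷ f) (b ∷ g) []      = ≈-refl
⊕-assoc (a ∷ f) (b ∷ g) (c ∷ h) = ∷-cong (ℤ.+-assoc a b c) (⊕-assoc f g h)

⊕-comm : ∀ f g → f ⊕ g ≈ g ⊕ f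
⊕-comm []      []      = ≈-refl
⊕-comm []      (b ∷ g) = ≈-refl
⊕-comm (a ∷ f) []      = ≈-refl
⊕-comm (a ∷ f) (b ∷ g) = ∷-cong (ℤ.+-comm a b) (⊕-comm f g)

⊕-identityʳ : ∀ f → f ⊕ 𝟘 ≈ f
⊕-identityʳ []      = ≈-refl
⊕-identityʳ (a ∷ f) = ≈-refl

⊝-inverseʳ : ∀ f → f ⊕ ⊝ f ≈ 𝟘
⊝-inverseʳ []      = ≈-refl
⊝-inverseʳ (a ∷ f) = ∷-≈𝟘 (ℤ.+-inverseʳ a) (⊝-inverseʳ f)

⊝-inverseˡ : ∀ f → ⊝ f ⊕ f ≈ 𝟘
⊝-inverseˡ f = ≈-trans (⊕-comm (⊝ f) f) (⊝-inverseʳ f)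

·-distrib-⊕ : ∀ c f g → c · (f ⊕ g) ≈ c · f ⊕ c · g
·-distrib-⊕ c []      g       = ≈-refl
·-distrib-⊕ c (a ∷ f) []      = ≈-refl
·-distrib-⊕ c (a ∷ f) (b ∷ g) = ∷-cong (ℤ.*-distribˡ-+ c a b) (·-distrib-⊕ c f g)

·-assoc : ∀ a b f → (a * b) · f ≈ a · (b · f)
·-assoc a b []      = ≈-refl
·-assoc a b (c ∷ f) = ∷-cong (ℤ.*-assoc a b c) (·-assoc a b f)

·-identity : ∀ f → 1ℤ · f ≈ f
·-identity []      = ≈-refl
·-identity (a ∷ f) = ∷-cong (ℤ.*-identityˡ a) (·-identity f)

0·-≈𝟘 : ∀ f → 0ℤ · f ≈ 𝟘
0·-≈𝟘 []      = ≈-refl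
0·-≈𝟘 (a ∷ f) = ∷-≈𝟘 refl (0·-≈𝟘 f)

open import Algebra.Structures {A = Poly} _≈_ using (IsCommutativeRing; IsCommutativeMonoid)

⊕-isCommutativeMonoid : IsCommutativeMonoid _⊕_ 𝟘
⊕-isCommutativeMonoid = record
  { isMonoid = record
    { isSemigroup = record
      { isMagma = record { isEquivalence = ≈-isEquivalence ; ∙-cong = ⊕-cong }
      ; assoc   = ⊕-assoc
      }
    ; identity = (λ _ → ≈-refl) , ⊕-identityʳ
    }
  ; comm = ⊕-comm
  }

⊕-commutativeSemigroup : CommutativeSemigroup 0ℓ 0ℓ
⊕-commutativeSemigroup = record
  { isCommutativeSemigroup = IsCommutativeMonoid.isCommutativeSemigroup ⊕-isCommutativeMonoid }

open import Algebra.Properties.CommutativeSemigroup ⊕-commutativeSemigroup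
  using (interchange; x∙yz≈y∙xz)
open import Relation.Binary.Reasoning.Setoid ≈-setoid

⊛-zeroʳ : ∀ f → f ⊛ 𝟘 ≈ 𝟘
⊛-zeroʳ []      = ≈-refl
⊛-zeroʳ (a ∷ f) = ∷-≈𝟘 refl (⊛-zeroʳ f)

⊛-congʳ : ∀ f {g g′} → g ≈ g′ → f ⊛ g ≈ f ⊛ g′
⊛-congʳ []      g≈g′ = ≈-refl
⊛-congʳ (a ∷ f) g≈g′ = ⊕-cong (·-congʳ a g≈g′) (∷-cong refl (⊛-congʳ f g≈g′))

⊛-∷ʳ : ∀ f a g → f ⊛ (a ∷ g) ≈ a · f ⊕ (0ℤ ∷ f ⊛ g)
⊛-∷ʳ []      a g = ≈-sym (∷-≈𝟘 refl ≈-refl)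
⊛-∷ʳ (b ∷ f) a g = ∷-cong (cong (_+ 0ℤ) (ℤ.*-comm b a)) (begin
  b · g ⊕ f ⊛ (a ∷ g)                 ≈⟨ ⊕-cong ≈-refl (⊛-∷ʳ f a g) ⟩
  b · g ⊕ (a · f ⊕ (0ℤ ∷ f ⊛ g))      ≈⟨ x∙yz≈y∙xz (b · g) (a · f) _ ⟩
  a · f ⊕ (b · g ⊕ (0ℤ ∷ f ⊛ g))      ∎)

⊛-comm : ∀ f g → f ⊛ g ≈ g ⊛ f
⊛-comm []      g = ≈-sym (⊛-zeroʳ g)
⊛-comm (a ∷ f) g = begin
  a · g ⊕ (0ℤ ∷ f ⊛ g)   ≈⟨ ⊕-cong ≈-refl (∷-cong refl (⊛-comm f g)) ⟩
  a · g ⊕ (0ℤ ∷ g ⊛ f)   ≈⟨ ⊛-∷ʳ g a f ⟨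
  g ⊛ (a ∷ f)            ∎

⊛-congˡ : ∀ {f f′} g → f ≈ f′ → f ⊛ g ≈ f′ ⊛ g
⊛-congˡ {f} {f′} g f≈f′ = begin
  f ⊛ g    ≈⟨ ⊛-comm f g ⟩
  g ⊛ f    ≈⟨ ⊛-congʳ g f≈f′ ⟩
  g ⊛ f′   ≈⟨ ⊛-comm g f′ ⟩
  f′ ⊛ g   ∎

⊛-distribˡ : ∀ f g h → f ⊛ (g ⊕ h) ≈ f ⊛ g ⊕ f ⊛ h
⊛-distribˡ []      g h = ≈-refl
⊛-distribˡ (a ∷ f) g h = begin
  a · (g ⊕ h) ⊕ (0ℤ ∷ f ⊛ (g ⊕ h))
    ≈⟨ ⊕-cong (·-distrib-⊕ a g h) (∷-cong refl (⊛-distribˡ f g h)) ⟩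
  (a · g ⊕ a · h) ⊕ ((0ℤ ∷ f ⊛ g) ⊕ (0ℤ ∷ f ⊛ h))
    ≈⟨ interchange (a · g) (a · h) _ _ ⟩
  (a · g ⊕ (0ℤ ∷ f ⊛ g)) ⊕ (a · h ⊕ (0ℤ ∷ f ⊛ h))
    ∎

⊛-distribʳ : ∀ f g h → (g ⊕ h) ⊛ f ≈ g ⊛ f ⊕ h ⊛ f
⊛-distribʳ f g h = begin
  (g ⊕ h) ⊛ f      ≈⟨ ⊛-comm (g ⊕ h) f ⟩
  f ⊛ (g ⊕ h)      ≈⟨ ⊛-distribˡ f g h ⟩
  f ⊛ g ⊕ f ⊛ h    ≈⟨ ⊕-cong (⊛-comm f g) (⊛-comm f h) ⟩
  g ⊛ f ⊕ h ⊛ f    ∎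

·-⊛ : ∀ c f g → (c · f) ⊛ g ≈ c · (f ⊛ g)
·-⊛ c []      g = ≈-refl
·-⊛ c (a ∷ f) g = begin
  (c * a) · g ⊕ (0ℤ ∷ (c · f) ⊛ g)    ≈⟨ ⊕-cong (·-assoc c a g) (∷-cong (sym (ℤ.*-zeroʳ c)) (·-⊛ c f g)) ⟩
  c · (a · g) ⊕ c · (0ℤ ∷ f ⊛ g)      ≈⟨ ·-distrib-⊕ c (a · g) _ ⟨
  c · (a · g ⊕ (0ℤ ∷ f ⊛ g))          ∎

0∷-⊛ : ∀ f g → (0ℤ ∷ f) ⊛ g ≈ 0ℤ ∷ f ⊛ g
0∷-⊛ f g = ⊕-cong (0·-≈𝟘 g) ≈-refl

⊛-assoc : ∀ f g h → (f ⊛ g) ⊛ h ≈ f ⊛ (g ⊛ h)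
⊛-assoc []      g h = ≈-refl
⊛-assoc (a ∷ f) g h = begin
  (a · g ⊕ (0ℤ ∷ f ⊛ g)) ⊛ h          ≈⟨ ⊛-distribʳ h (a · g) _ ⟩
  (a · g) ⊛ h ⊕ (0ℤ ∷ f ⊛ g) ⊛ h      ≈⟨ ⊕-cong (·-⊛ a g h) (0∷-⊛ (f ⊛ g) h) ⟩
  a · (g ⊛ h) ⊕ (0ℤ ∷ (f ⊛ g) ⊛ h)    ≈⟨ ⊕-cong ≈-refl (∷-cong refl (⊛-assoc f g h)) ⟩
  a · (g ⊛ h) ⊕ (0ℤ ∷ f ⊛ (g ⊛ h))    ∎

⊛-identityˡ : ∀ f → 𝟙 ⊛ f ≈ f
⊛-identityˡ f = begin
  1ℤ · f ⊕ (0ℤ ∷ 𝟘)   ≈⟨ ⊕-cong (·-identity f) (∷-≈𝟘 refl ≈-refl) ⟩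
  f ⊕ 𝟘               ≈⟨ ⊕-identityʳ f ⟩
  f                   ∎

Poly-isCommutativeRing : IsCommutativeRing _⊕_ _⊛_ ⊝_ 𝟘 𝟙
Poly-isCommutativeRing = record
  { isRing = record
    { +-isAbelianGroup = record
      { isGroup = record
        { isMonoid = IsCommutativeMonoid.isMonoid ⊕-isCommutativeMonoid
        ; inverse  = ⊝-inverseˡ , ⊝-inverseʳ
        ; ⁻¹-cong  = ⊝-cong
        }
      ; comm = ⊕-comm
      }
    ; *-cong   = λ {f f′ g g′} f≈f′ g≈g′ → ≈-trans (⊛-congˡ g f≈f′) (⊛-congʳ f′ g≈g′)
    ; *-assoc  = ⊛-assoc
    ; *-identity = ⊛-identityˡ , (λ f → ≈-trans (⊛-comm f 𝟙) (⊛-identityˡ f))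
    ; distrib  = ⊛-distribˡ , ⊛-distribʳ
    }
  ; *-comm = ⊛-comm
  }

Poly-commutativeRing : CommutativeRing 0ℓ 0ℓ
Poly-commutativeRing = record { isCommutativeRing = Poly-isCommutativeRing }

isZero⇒≈𝟘 : ∀ {f} → IsZeroPoly f → f ≈ 𝟘
isZero⇒≈𝟘 []          = ≈-refl
isZero⇒≈𝟘 (a≡0 ∷ f≡0) = ∷-≈𝟘 a≡0 (isZero⇒≈𝟘 f≡0)

Poly-almostCommutativeRing : AlmostCommutativeRing 0ℓ 0ℓ
Poly-almostCommutativeRing = fromCommutativeRing Poly-commutativeRing 𝟘≟_
  where
  -- lets the solver discard coefficients such as 0ℤ ∷ [], which vanish only up to trailing zeros
  𝟘≟_ : ∀ f → Maybe (𝟘 ≈ f)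
  𝟘≟ f with all? (ℤ._≟ 0ℤ) f
  ... | yes f≡0 = just (≈-sym (isZero⇒≈𝟘 f≡0))
  ... | no _    = nothing

coeff-nonNeg : ∀ {f} → NonNegCoeffs f → ∀ k → 0ℤ ≤ coeff f k
coeff-nonNeg []          _       = ℤ.≤-refl
coeff-nonNeg (a≥0 ∷ _)   zero    = a≥0
coeff-nonNeg (_ ∷ f≥0)   (suc k) = coeff-nonNeg f≥0 k

nonNeg-coeff : ∀ f → (∀ k → 0ℤ ≤ coeff f k) → NonNegCoeffs f
nonNeg-coeff []      _       = []
nonNeg-coeff (a ∷ f) coeff≥0 = coeff≥0 zero ∷ nonNeg-coeff f (coeff≥0 ∘ suc)

nonZero-coeff : ∀ {f} → NonZeroPoly f → ∃ λ k → coeff f k ≢ 0ℤ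
nonZero-coeff (here a≢0)  = zero , a≢0
nonZero-coeff (there f≢0) = let k , fₖ≢0 = nonZero-coeff f≢0 in suc k , fₖ≢0

coeff-nonZero : ∀ f k → coeff f k ≢ 0ℤ → NonZeroPoly f
coeff-nonZero []      _       0≢0  = ⊥-elim (0≢0 refl)
coeff-nonZero (a ∷ f) zero    a≢0  = here a≢0
coeff-nonZero (a ∷ f) (suc k) fₖ≢0 = there (coeff-nonZero f k fₖ≢0)

nonNeg-resp-≈ : ∀ {f g} → f ≈ g → NonNegCoeffs f → NonNegCoeffs g
nonNeg-resp-≈ {g = g} (coeffwise f≈g) f≥0 =
  nonNeg-coeff g λ k → subst (0ℤ ≤_) (f≈g k) (coeff-nonNeg f≥0 k)

nonZero-resp-≈ : ∀ {f g} → f ≈ g → NonZeroPoly f → NonZeroPoly g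
nonZero-resp-≈ {g = g} (coeffwise f≈g) f≢0 =
  let k , fₖ≢0 = nonZero-coeff f≢0 in coeff-nonZero g k (fₖ≢0 ∘ trans (f≈g k))

nonzeroNonneg-resp-≈ : ∀ {f g} → f ≈ g → NonzeroNonneg f → NonzeroNonneg g
nonzeroNonneg-resp-≈ f≈g (f≢0 , f≥0) = nonZero-resp-≈ f≈g f≢0 , nonNeg-resp-≈ f≈g f≥0

*-nonNeg : ∀ {a b} → 0ℤ ≤ a → 0ℤ ≤ b → 0ℤ ≤ a * b
*-nonNeg {+ m} {+ n} _ _ = subst (0ℤ ≤_) (ℤ.pos-* m n) (+≤+ z≤n)

*-≢0 : ∀ {a b} → a ≢ 0ℤ → b ≢ 0ℤ → a * b ≢ 0ℤ
*-≢0 {a} a≢0 b≢0 ab≡0 = [ a≢0 , b≢0 ]′ (ℤ.i*j≡0⇒i≡0∨j≡0 a ab≡0)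

+-≢0ˡ : ∀ {a b} → 0ℤ ≤ a → a ≢ 0ℤ → 0ℤ ≤ b → a + b ≢ 0ℤ
+-≢0ˡ a≥0 a≢0 b≥0 = ≢-sym (ℤ.<⇒≢ (ℤ.+-mono-<-≤ (ℤ.≤∧≢⇒< a≥0 (≢-sym a≢0)) b≥0))

nonNeg-⊕ : ∀ {f g} → NonNegCoeffs f → NonNegCoeffs g → NonNegCoeffs (f ⊕ g)
nonNeg-⊕ []          g≥0         = g≥0
nonNeg-⊕ (a≥0 ∷ f≥0) []          = a≥0 ∷ f≥0
nonNeg-⊕ (a≥0 ∷ f≥0) (b≥0 ∷ g≥0) = ℤ.+-mono-≤ a≥0 b≥0 ∷ nonNeg-⊕ f≥0 g≥0

nonNeg-· : ∀ {c f} → 0ℤ ≤ c → NonNegCoeffs f → NonNegCoeffs (c · f)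
nonNeg-· c≥0 = All.gmap⁺ (*-nonNeg c≥0)

nonNeg-⊛ : ∀ {f g} → NonNegCoeffs f → NonNegCoeffs g → NonNegCoeffs (f ⊛ g)
nonNeg-⊛ []          _   = []
nonNeg-⊛ (a≥0 ∷ f≥0) g≥0 = nonNeg-⊕ (nonNeg-· a≥0 g≥0) (ℤ.≤-refl ∷ nonNeg-⊛ f≥0 g≥0)

nonzeroNonneg-⊕ˡ : ∀ {f g} → NonzeroNonneg f → NonNegCoeffs g → NonzeroNonneg (f ⊕ g)
nonzeroNonneg-⊕ˡ (f≢0 , f≥0) g≥0 = nonZero-⊕ f≢0 f≥0 g≥0 , nonNeg-⊕ f≥0 g≥0
  where
  nonZero-⊕ : ∀ {f g} → NonZeroPoly f → NonNegCoeffs f → NonNegCoeffs g → NonZeroPoly (f ⊕ g)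
  nonZero-⊕ (here a≢0)  _         []        = here a≢0
  nonZero-⊕ (there f≢0) _         []        = there f≢0
  nonZero-⊕ (here a≢0)  (a≥0 ∷ _) (b≥0 ∷ _) = here (+-≢0ˡ a≥0 a≢0 b≥0)
  nonZero-⊕ (there f≢0) (_ ∷ f≥0) (_ ∷ g≥0) = there (nonZero-⊕ f≢0 f≥0 g≥0)

nonzeroNonneg-⊕ʳ : ∀ {f g} → NonNegCoeffs f → NonzeroNonneg g → NonzeroNonneg (f ⊕ g)
nonzeroNonneg-⊕ʳ {f} {g} f≥0 g⁺ = nonzeroNonneg-resp-≈ (⊕-comm g f) (nonzeroNonneg-⊕ˡ g⁺ f≥0)

nonzeroNonneg-· : ∀ {c f} → 0ℤ ≤ c → c ≢ 0ℤ → NonzeroNonneg f → NonzeroNonneg (c · f)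
nonzeroNonneg-· c≥0 c≢0 (f≢0 , f≥0) = Any.gmap (*-≢0 c≢0) f≢0 , nonNeg-· c≥0 f≥0

nonzeroNonneg-⊛ : ∀ {f g} → NonzeroNonneg f → NonzeroNonneg g → NonzeroNonneg (f ⊛ g)
nonzeroNonneg-⊛ (here a≢0 , a≥0 ∷ f≥0) g⁺@(_ , g≥0) =
  nonzeroNonneg-⊕ˡ (nonzeroNonneg-· a≥0 a≢0 g⁺) (ℤ.≤-refl ∷ nonNeg-⊛ f≥0 g≥0)
nonzeroNonneg-⊛ (there f≢0 , a≥0 ∷ f≥0) g⁺@(_ , g≥0) =
  let fg≢0 , fg≥0 = nonzeroNonneg-⊛ (f≢0 , f≥0) g⁺
  in  nonzeroNonneg-⊕ʳ (nonNeg-· a≥0 g≥0) (there fg≢0 , ℤ.≤-refl ∷ fg≥0)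

nonNegCoeffs? : Decidable NonNegCoeffs
nonNegCoeffs? = all? (0ℤ ℤ.≤?_)

nonzeroNonneg? : Decidable NonzeroNonneg
nonzeroNonneg? f = any? (λ c → ¬? (c ℤ.≟ 0ℤ)) f ×-dec nonNegCoeffs? f

Entrywise : (Poly → Set) → Mat → Set
Entrywise P S = P (m S) × P (n S) × P (o S) × P (p S)

entrywise? : ∀ {P} → Decidable P → Decidable (Entrywise P)
entrywise? P? S = P? (m S) ×-dec P? (n S) ×-dec P? (o S) ×-dec P? (p S)

infix 4 _≈ₘ_
_≈ₘ_ : Mat → Mat → Set
S ≈ₘ T = m S ≈ m T × n S ≈ n T × o S ≈ o T × p S ≈ p T

≈ₘ-sym : ∀ {S T} → S ≈ₘ T → T ≈ₘ S
≈ₘ-sym (m≈ , n≈ , o≈ , p≈) = ≈-sym m≈ , ≈-sym n≈ , ≈-sym o≈ , ≈-sym p≈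

≈ₘ-trans : ∀ {S T U} → S ≈ₘ T → T ≈ₘ U → S ≈ₘ U
≈ₘ-trans (m≈ , n≈ , o≈ , p≈) (m≈′ , n≈′ , o≈′ , p≈′) =
  ≈-trans m≈ m≈′ , ≈-trans n≈ n≈′ , ≈-trans o≈ o≈′ , ≈-trans p≈ p≈′

entrywise-resp-≈ₘ : ∀ {S T} → S ≈ₘ T → Entrywise NonzeroNonneg S → Entrywise NonzeroNonneg T
entrywise-resp-≈ₘ (m≈ , n≈ , o≈ , p≈) (m⁺ , n⁺ , o⁺ , p⁺) =
  nonzeroNonneg-resp-≈ m≈ m⁺ , nonzeroNonneg-resp-≈ n≈ n⁺ ,
  nonzeroNonneg-resp-≈ o≈ o⁺ , nonzeroNonneg-resp-≈ p≈ p⁺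

⊗-congʳ : ∀ S {T T′} → T ≈ₘ T′ → S ⊗ T ≈ₘ S ⊗ T′
⊗-congʳ (mat a b c d) (m≈ , n≈ , o≈ , p≈) =
  ⊕-cong (⊛-congʳ a m≈) (⊛-congʳ b o≈) , ⊕-cong (⊛-congʳ a n≈) (⊛-congʳ b p≈) ,
  ⊕-cong (⊛-congʳ c m≈) (⊛-congʳ d o≈) , ⊕-cong (⊛-congʳ c n≈) (⊛-congʳ d p≈)

⊗-assoc : ∀ S T U → (S ⊗ T) ⊗ U ≈ₘ S ⊗ (T ⊗ U)
⊗-assoc (mat a b c d) (mat a′ b′ c′ d′) (mat a″ b″ c″ d″) =
  entry a b a′ b′ c′ d′ a″ c″ , entry a b a′ b′ c′ d′ b″ d″ ,
  entry c d a′ b′ c′ d′ a″ c″ , entry c d a′ b′ c′ d′ b″ d″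
  where
  entry : ∀ x₁ x₂ y₁₁ y₁₂ y₂₁ y₂₂ z₁ z₂ →
    (x₁ ⊛ y₁₁ ⊕ x₂ ⊛ y₂₁) ⊛ z₁ ⊕ (x₁ ⊛ y₁₂ ⊕ x₂ ⊛ y₂₂) ⊛ z₂
      ≈ x₁ ⊛ (y₁₁ ⊛ z₁ ⊕ y₁₂ ⊛ z₂) ⊕ x₂ ⊛ (y₂₁ ⊛ z₁ ⊕ y₂₂ ⊛ z₂)
  entry = solve-∀ Poly-almostCommutativeRing

⊗-identityˡ : ∀ S → I₂ ⊗ S ≈ₘ S
⊗-identityˡ (mat a b c d) = entry a c , entry b d , entry′ a c , entry′ b d
  where
  entry : ∀ x y → 𝟙 ⊛ x ⊕ 𝟘 ⊛ y ≈ x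
  entry = solve-∀ Poly-almostCommutativeRing
  entry′ : ∀ x y → 𝟘 ⊛ x ⊕ 𝟙 ⊛ y ≈ y
  entry′ = solve-∀ Poly-almostCommutativeRing

⊗-identityʳ : ∀ S → S ⊗ I₂ ≈ₘ S
⊗-identityʳ (mat a b c d) = entry a b , entry′ a b , entry c d , entry′ c d
  where
  entry : ∀ x y → x ⊛ 𝟙 ⊕ y ⊛ 𝟘 ≈ x
  entry = solve-∀ Poly-almostCommutativeRing
  entry′ : ∀ x y → x ⊛ 𝟘 ⊕ y ⊛ 𝟙 ≈ y
  entry′ = solve-∀ Poly-almostCommutativeRing

μ-∷ʳ : ∀ w a → μ (w ∷ʳ a) ≈ₘ μ w ⊗ μ₁ a
μ-∷ʳ []      a = ≈ₘ-trans (⊗-identityʳ (μ₁ a)) (≈ₘ-sym (⊗-identityˡ (μ₁ a)))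
μ-∷ʳ (b ∷ w) a = ≈ₘ-trans (⊗-congʳ (μ₁ b) (μ-∷ʳ w a)) (≈ₘ-sym (⊗-assoc (μ₁ b) (μ w) (μ₁ a)))

Λ₁ Λ₂ : Mat → Poly
Λ₁ S = qpow 1 ⊛ m S ⊖ qpow 2 ⊛ n S ⊕ o S
Λ₂ S = (qpow 1 ⊕ qpow 2) ⊛ m S ⊖ (qpow 2 ⊕ qpow 3 ⊕ qpow 4) ⊛ n S ⊕ o S ⊖ qpow 1 ⊛ p S

Λ₁-cong : ∀ {S T} → S ≈ₘ T → Λ₁ S ≈ Λ₁ T
Λ₁-cong (m≈ , n≈ , o≈ , _) = ⊕-cong (⊕-cong (⊛-congʳ (qpow 1) m≈) (⊝-cong (⊛-congʳ (qpow 2) n≈))) o≈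

Λ₂-cong : ∀ {S T} → S ≈ₘ T → Λ₂ S ≈ Λ₂ T
Λ₂-cong (m≈ , n≈ , o≈ , p≈) =
  ⊕-cong (⊕-cong (⊕-cong (⊛-congʳ (qpow 1 ⊕ qpow 2) m≈) (⊝-cong (⊛-congʳ (qpow 2 ⊕ qpow 3 ⊕ qpow 4) n≈))) o≈)
         (⊝-cong (⊛-congʳ (qpow 1) p≈))

⟪_,_⟫ : Mat → Mat → Poly
⟪ C , S ⟫ = m C ⊛ m S ⊕ n C ⊛ n S ⊕ o C ⊛ o S ⊕ p C ⊛ p S

⟪⟫-nonNeg : ∀ {C S} → Entrywise NonNegCoeffs C → Entrywise NonNegCoeffs S → NonNegCoeffs ⟪ C , S ⟫
⟪⟫-nonNeg (c₁ , c₂ , c₃ , c₄) (s₁ , s₂ , s₃ , s₄) =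
  nonNeg-⊕ (nonNeg-⊕ (nonNeg-⊕ (nonNeg-⊛ c₁ s₁) (nonNeg-⊛ c₂ s₂)) (nonNeg-⊛ c₃ s₃)) (nonNeg-⊛ c₄ s₄)

⟪⟫-nonzeroNonneg : ∀ {C S} → Entrywise NonNegCoeffs C → Entrywise NonNegCoeffs S →
  NonzeroNonneg (p C) → NonzeroNonneg (p S) → NonzeroNonneg ⟪ C , S ⟫
⟪⟫-nonzeroNonneg (c₁ , c₂ , c₃ , _) (s₁ , s₂ , s₃ , _) c₄⁺ s₄⁺ =
  nonzeroNonneg-⊕ʳ (nonNeg-⊕ (nonNeg-⊕ (nonNeg-⊛ c₁ s₁) (nonNeg-⊛ c₂ s₂)) (nonNeg-⊛ c₃ s₃))
                   (nonzeroNonneg-⊛ c₄⁺ s₄⁺)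

Λ₁-coeffs Λ₂-coeffs : Mat → Mat
Λ₁-coeffs (mat a b c d) = mat (qpow 1 ⊛ a ⊖ qpow 2 ⊛ b) (qpow 1 ⊛ c ⊖ qpow 2 ⊛ d) a c
Λ₂-coeffs (mat a b c d) =
  mat ((qpow 1 ⊕ qpow 2) ⊛ a ⊖ (qpow 2 ⊕ qpow 3 ⊕ qpow 4) ⊛ b ⊖ qpow 3)
      ((qpow 1 ⊕ qpow 2) ⊛ c ⊖ (qpow 2 ⊕ qpow 3 ⊕ qpow 4) ⊛ d ⊕ qpow 4)
      (a ⊖ qpow 1 ⊛ b ⊖ qpow 2)
      (c ⊖ qpow 1 ⊛ d)

Λ₁-⊗ : ∀ S T → Λ₁ (S ⊗ T) ≈ ⟪ Λ₁-coeffs T , S ⟫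
Λ₁-⊗ (mat m n o p) (mat a b c d) = identity (qpow 1) (qpow 2) m n o p a b c d
  where
  identity : ∀ α β m n o p a b c d →
    α ⊛ (m ⊛ a ⊕ n ⊛ c) ⊖ β ⊛ (m ⊛ b ⊕ n ⊛ d) ⊕ (o ⊛ a ⊕ p ⊛ c)
      ≈ (α ⊛ a ⊖ β ⊛ b) ⊛ m ⊕ (α ⊛ c ⊖ β ⊛ d) ⊛ n ⊕ a ⊛ o ⊕ c ⊛ p
  identity = solve-∀ Poly-almostCommutativeRing

Λ₂-⊗ : ∀ S T → Λ₂ (S ⊗ T) ≈ qpow 2 ⊛ Λ₁ S ⊕ ⟪ Λ₂-coeffs T , S ⟫
Λ₂-⊗ (mat m n o p) (mat a b c d) =
  identity (qpow 2) (qpow 1 ⊕ qpow 2) (qpow 2 ⊕ qpow 3 ⊕ qpow 4) (qpow 1) (qpow 1) (qpow 2) m n o p a b c d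
  where
  identity : ∀ κ α β γ α₁ β₁ m n o p a b c d →
    α ⊛ (m ⊛ a ⊕ n ⊛ c) ⊖ β ⊛ (m ⊛ b ⊕ n ⊛ d) ⊕ (o ⊛ a ⊕ p ⊛ c) ⊖ γ ⊛ (o ⊛ b ⊕ p ⊛ d)
      ≈ κ ⊛ (α₁ ⊛ m ⊖ β₁ ⊛ n ⊕ o)
        ⊕ ((α ⊛ a ⊖ β ⊛ b ⊖ κ ⊛ α₁) ⊛ m ⊕ (α ⊛ c ⊖ β ⊛ d ⊕ κ ⊛ β₁) ⊛ n
           ⊕ (a ⊖ γ ⊛ b ⊖ κ) ⊛ o ⊕ (c ⊖ γ ⊛ d) ⊛ p)
  identity = solve-∀ Poly-almostCommutativeRing

⊗-nonzeroNonneg : ∀ {S T} → NonzeroNonneg (m S) → NonNegCoeffs (n S) → NonNegCoeffs (o S) → NonzeroNonneg (p S) →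
  Entrywise NonzeroNonneg T → Entrywise NonzeroNonneg (S ⊗ T)
⊗-nonzeroNonneg m⁺ n≥0 o≥0 p⁺ (a⁺ , b⁺ , c⁺ , d⁺) =
  nonzeroNonneg-⊕ˡ (nonzeroNonneg-⊛ m⁺ a⁺) (nonNeg-⊛ n≥0 (proj₂ c⁺)) ,
  nonzeroNonneg-⊕ˡ (nonzeroNonneg-⊛ m⁺ b⁺) (nonNeg-⊛ n≥0 (proj₂ d⁺)) ,
  nonzeroNonneg-⊕ʳ (nonNeg-⊛ o≥0 (proj₂ a⁺)) (nonzeroNonneg-⊛ p⁺ c⁺) ,
  nonzeroNonneg-⊕ʳ (nonNeg-⊛ o≥0 (proj₂ b⁺)) (nonzeroNonneg-⊛ p⁺ d⁺)

μ₁-nonzeroNonneg : ∀ a → Entrywise NonzeroNonneg (μ₁ a)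
μ₁-nonzeroNonneg 𝟶 = from-yes (entrywise? nonzeroNonneg? (μ₁ 𝟶))
μ₁-nonzeroNonneg 𝟷 = from-yes (entrywise? nonzeroNonneg? (μ₁ 𝟷))

Λ₁-coeffs-nonNeg : ∀ a → Entrywise NonNegCoeffs (Λ₁-coeffs (μ₁ a))
Λ₁-coeffs-nonNeg 𝟶 = from-yes (entrywise? nonNegCoeffs? (Λ₁-coeffs (μ₁ 𝟶)))
Λ₁-coeffs-nonNeg 𝟷 = from-yes (entrywise? nonNegCoeffs? (Λ₁-coeffs (μ₁ 𝟷)))

Λ₂-coeffs-nonNeg : ∀ a → Entrywise NonNegCoeffs (Λ₂-coeffs (μ₁ a))
Λ₂-coeffs-nonNeg 𝟶 = from-yes (entrywise? nonNegCoeffs? (Λ₂-coeffs (μ₁ 𝟶)))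
Λ₂-coeffs-nonNeg 𝟷 = from-yes (entrywise? nonNegCoeffs? (Λ₂-coeffs (μ₁ 𝟷)))

record Invariant (S : Mat) : Set where
  field
    m⁺  : NonzeroNonneg (m S)
    n≥0 : NonNegCoeffs (n S)
    o≥0 : NonNegCoeffs (o S)
    p⁺  : NonzeroNonneg (p S)
    Λ₁⁺ : NonzeroNonneg (Λ₁ S)
    Λ₂⁺ : NonzeroNonneg (Λ₂ S)

  entries≥0 : Entrywise NonNegCoeffs S
  entries≥0 = proj₂ m⁺ , n≥0 , o≥0 , proj₂ p⁺

invariant-resp-≈ₘ : ∀ {S T} → S ≈ₘ T → Invariant S → Invariant T
invariant-resp-≈ₘ S≈T@(m≈ , n≈ , o≈ , p≈) inv = record
  { m⁺  = nonzeroNonneg-resp-≈ m≈ m⁺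
  ; n≥0 = nonNeg-resp-≈ n≈ n≥0
  ; o≥0 = nonNeg-resp-≈ o≈ o≥0
  ; p⁺  = nonzeroNonneg-resp-≈ p≈ p⁺
  ; Λ₁⁺ = nonzeroNonneg-resp-≈ (Λ₁-cong S≈T) Λ₁⁺
  ; Λ₂⁺ = nonzeroNonneg-resp-≈ (Λ₂-cong S≈T) Λ₂⁺
  }
  where open Invariant inv

invariant-I₂ : Invariant I₂
invariant-I₂ = record
  { m⁺  = from-yes (nonzeroNonneg? 𝟙)
  ; n≥0 = []
  ; o≥0 = []
  ; p⁺  = from-yes (nonzeroNonneg? 𝟙)
  ; Λ₁⁺ = from-yes (nonzeroNonneg? (Λ₁ I₂))
  ; Λ₂⁺ = from-yes (nonzeroNonneg? (Λ₂ I₂))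
  }

⊗μ₁-nonzeroNonneg : ∀ a {S} → Invariant S → Entrywise NonzeroNonneg (S ⊗ μ₁ a)
⊗μ₁-nonzeroNonneg a inv = ⊗-nonzeroNonneg m⁺ n≥0 o≥0 p⁺ (μ₁-nonzeroNonneg a)
  where open Invariant inv

invariant-⊗μ₁ : ∀ a {S} → Invariant S → Invariant (S ⊗ μ₁ a)
invariant-⊗μ₁ a {S} inv =
  let m⁺′ , (_ , n≥0′) , (_ , o≥0′) , p⁺′ = ⊗μ₁-nonzeroNonneg a inv
      _ , _ , c⁺ , _ = μ₁-nonzeroNonneg a
  in record
    { m⁺  = m⁺′
    ; n≥0 = n≥0′
    ; o≥0 = o≥0′
    ; p⁺  = p⁺′
    ; Λ₁⁺ = nonzeroNonneg-resp-≈ (≈-sym (Λ₁-⊗ S (μ₁ a)))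
              (⟪⟫-nonzeroNonneg (Λ₁-coeffs-nonNeg a) entries≥0 c⁺ p⁺)
    ; Λ₂⁺ = nonzeroNonneg-resp-≈ (≈-sym (Λ₂-⊗ S (μ₁ a)))
              (nonzeroNonneg-⊕ˡ (nonzeroNonneg-⊛ (from-yes (nonzeroNonneg? (qpow 2))) Λ₁⁺)
                                (⟪⟫-nonNeg (Λ₂-coeffs-nonNeg a) entries≥0))
    }
  where open Invariant inv

invariant : ∀ {w} → Reverse w → Invariant (μ w)
invariant []            = invariant-I₂
invariant (v ∶ rv ∶ʳ a) = invariant-resp-≈ₘ (≈ₘ-sym (μ-∷ʳ v a)) (invariant-⊗μ₁ a (invariant rv))

μ-nonzeroNonneg : ∀ {w} → Reverse w → ¬ (w ≡ []) → Entrywise NonzeroNonneg (μ w)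
μ-nonzeroNonneg []            w≢[] = ⊥-elim (w≢[] refl)
μ-nonzeroNonneg (v ∶ rv ∶ʳ a) _    =
  entrywise-resp-≈ₘ (≈ₘ-sym (μ-∷ʳ v a)) (⊗μ₁-nonzeroNonneg a (invariant rv))

lemma3p3 : (w : Word) →
    NonzeroNonneg (m (μ w))
    × NonzeroNonneg (p (μ w))
    × NonzeroNonneg (qpow 1 ⊛ m (μ w) ⊖ qpow 2 ⊛ n (μ w) ⊕ o (μ w))
    × NonzeroNonneg ((qpow 1 ⊕ qpow 2) ⊛ m (μ w) ⊖ (qpow 2 ⊕ qpow 3 ⊕ qpow 4) ⊛ n (μ w) ⊕ o (μ w) ⊖ qpow 1 ⊛ p (μ w))
    × (w ≡ [] → IsZeroPoly (o (μ w)) × IsZeroPoly (n (μ w)))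
    × (¬ (w ≡ []) → NonzeroNonneg (o (μ w)) × NonzeroNonneg (n (μ w)))
lemma3p3 w = m⁺ , p⁺ , Λ₁⁺ , Λ₂⁺ , (λ { refl → [] , [] }) , off-diagonal
  where
  open Invariant (invariant (reverseView w))
  off-diagonal : ¬ (w ≡ []) → NonzeroNonneg (o (μ w)) × NonzeroNonneg (n (μ w))
  off-diagonal w≢[] = let _ , n⁺ , o⁺ , _ = μ-nonzeroNonneg (reverseView w) w≢[] in o⁺ , n⁺
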